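{- Let $\Gamma$ be a finite graph and $G\le\mathrm{Aut}(\Gamma)$ a transitive, imprimitive group on $V\Gamma$. Let $\mathcal B$ be a block system for $G$ and suppose that for some $B\in\mathcal B$ the pointwise stabiliser $G_{(V\Gamma\setminus B)}$ is transitive on $B$. Then $\Gamma$ is isomorphic to the lexicographic product $(\Gamma/\mathcal B)[\Gamma[B]]$.
   Context: Graphs are finite, simple, undirected. A block system of a transitive group $G$ is a $G$-invariant partition of the point set into sets of size $\ge2$; $G$ is imprimitive if it has a block system other than the one-block partition. $G_{(S)}$ is the pointwise stabiliser of $S$. $\Gamma[B]$ is the subgraph induced on $B$. $\Gamma/\mathcal B$ is the quotient graph with vertex set $\mathcal B$, where distinct $B_1,B_2$ are adjacent iff some vertex of $B_1$ is adjacent to some vertex of $B_2$. For graphs $\Theta,\Delta$, the lexicographic product $\Theta[\Delta]$ has vertex set $V\Delta\times V\Theta$, with $(\delta_1,\theta_1)\sim(\delta_2,\theta_2)$ iff either $\theta_1=\theta_2$ and $\delta_1\sim\delta_2$, or $\theta_1\sim\theta_2$. -}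

module Defs where

open import Data.Nat using (ℕ)
open import Data.Fin using (Fin)
open import Data.Fin.Permutation using (Permutation′; _⟨$⟩ʳ_; _∘ₚ_; flip; id; _≈_)
open import Data.Product using (Σ; ∃; _×_; _,_; proj₁)
open import Data.Sum using (_⊎_)
open import Relation.Binary.PropositionalEquality using (_≡_; _≢_)
open import Relation.Nullary using (¬_; Dec)
open import Function.Bundles using (_↔_; Inverse)

record Graph (V : Set) : Set₁ where
  field
    Adj    : V → V → Set
    sym    : ∀ {x y} → Adj x y → Adj y x
    irrefl : ∀ {x} → ¬ Adj x x
open Graph public

record FinGraph (n : ℕ) : Set₁ where
  field
    graph  : Graph (Fin n)
    adj?   : ∀ x y → Dec (Adj graph x y)
open FinGraph public

_≅_ : {V W : Set} → Graph V → Graph W → Set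
_≅_ {V} {W} Γ Δ = Σ (V ↔ W) λ f →
  ∀ x y → (Adj Γ x y → Adj Δ (Inverse.to f x) (Inverse.to f y))
        × (Adj Δ (Inverse.to f x) (Inverse.to f y) → Adj Γ x y)

record IsSubgroup (n : ℕ) (G : Permutation′ n → Set) : Set where
  field
    resp    : ∀ {g h} → g ≈ h → G g → G h
    has-id  : G id
    has-∘   : ∀ {g h} → G g → G h → G (g ∘ₚ h)
    has-inv : ∀ {g} → G g → G (flip g)
open IsSubgroup public

IsAutGroup : {n : ℕ} → Graph (Fin n) → (Permutation′ n → Set) → Set
IsAutGroup {n} Γ G = IsSubgroup n G ×
  (∀ g → G g → ∀ x y → (Adj Γ x y → Adj Γ (g ⟨$⟩ʳ x) (g ⟨$⟩ʳ y))
                     × (Adj Γ (g ⟨$⟩ʳ x) (g ⟨$⟩ʳ y) → Adj Γ x y))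

IsTransitive : {n : ℕ} → (Permutation′ n → Set) → Set
IsTransitive {n} G = ∀ (x y : Fin n) → ∃ λ g → G g × g ⟨$⟩ʳ x ≡ y

-- A partition of Fin n into m blocks, encoded by the block-label map
-- blk : Fin n → Fin m (every label used, every block of size ≥ 2),
-- which is G-invariant (each g ∈ G maps blocks into blocks).
record IsBlockSystem {n : ℕ} (G : Permutation′ n → Set) (m : ℕ) (blk : Fin n → Fin m) : Set where
  field
    surj      : ∀ (b : Fin m) → ∃ λ x → blk x ≡ b
    size≥2    : ∀ (b : Fin m) → ∃ λ x → ∃ λ y → blk x ≡ b × blk y ≡ b × x ≢ y
    invariant : ∀ g → G g → ∀ x y → blk x ≡ blk y → blk (g ⟨$⟩ʳ x) ≡ blk (g ⟨$⟩ʳ y)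
open IsBlockSystem public

IsImprimitive : {n : ℕ} → (Permutation′ n → Set) → Set
IsImprimitive {n} G = ∃ λ m → ∃ λ (blk : Fin n → Fin m) → IsBlockSystem G m blk × m ≢ 1

PointwiseStabTransitiveOn : {n m : ℕ} → (Permutation′ n → Set) → (Fin n → Fin m) → Fin m → Set
PointwiseStabTransitiveOn {n} G blk b =
  ∀ (x y : Fin n) → blk x ≡ b → blk y ≡ b →
    ∃ λ g → G g × (∀ z → blk z ≢ b → g ⟨$⟩ʳ z ≡ z) × g ⟨$⟩ʳ x ≡ y

quotient : {n m : ℕ} → Graph (Fin n) → (Fin n → Fin m) → Graph (Fin m)
quotient {n} {m} Γ blk = record
  { Adj = QA
  ; sym = λ { (c≢d , x , y , bx , by , a) → (λ e → c≢d (symm e)) , y , x , by , bx , Graph.sym Γ a }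
  ; irrefl = λ { (c≢c , _) → c≢c Relation.Binary.PropositionalEquality.refl }
  }
  where
  open Relation.Binary.PropositionalEquality using () renaming (sym to symm)
  QA : Fin m → Fin m → Set
  QA c d = c ≢ d × ∃ λ x → ∃ λ y → blk x ≡ c × blk y ≡ d × Adj Γ x y

induced : {n m : ℕ} → Graph (Fin n) → (blk : Fin n → Fin m) → (b : Fin m) →
          Graph (Σ (Fin n) λ x → blk x ≡ b)
induced Γ blk b = record
  { Adj = λ u v → Adj Γ (proj₁ u) (proj₁ v)
  ; sym = Graph.sym Γ
  ; irrefl = Graph.irrefl Γ
  }

lex : {VΘ VΔ : Set} → Graph VΘ → Graph VΔ → Graph (VΔ × VΘ)
lex {VΘ} {VΔ} Θ Δ = record
  { Adj = LA
  ; sym = λ { (Data.Sum.inj₁ (e , a)) → Data.Sum.inj₁ (symm e , Graph.sym Δ a)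
            ; (Data.Sum.inj₂ a) → Data.Sum.inj₂ (Graph.sym Θ a) }
  ; irrefl = λ { (Data.Sum.inj₁ (_ , a)) → Graph.irrefl Δ a
               ; (Data.Sum.inj₂ a) → Graph.irrefl Θ a }
  }
  where
  open Relation.Binary.PropositionalEquality using () renaming (sym to symm)
  LA : VΔ × VΘ → VΔ × VΘ → Set
  LA (δ₁ , θ₁) (δ₂ , θ₂) = (θ₁ ≡ θ₂ × Adj Δ δ₁ δ₂) ⊎ Adj Θ θ₁ θ₂

{-# OPTIONS --safe #-}
-- If u and u' lie in the block B and v lies outside it, an element of G_(VΓ∖B) moving
-- u to u' fixes v, so u and u' have the same neighbours outside B: B is a module of Γ.
-- Since G is transitive and preserves 𝓑, for every block C some σ_C ∈ G ≤ Aut(Γ) maps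
-- C onto B, so every block is a module and Γ[C] ≅ Γ[B]. Sending x ∈ C to (σ_C x, C)
-- is then an isomorphism Γ ≅ (Γ/𝓑)[Γ[B]]: edges inside C are carried by σ_C, and
-- edges between distinct blocks exist between all or no pairs of their vertices.
module Submission where

open import Defs hiding (sym)
open import Data.Nat using (ℕ)
open import Data.Fin using (Fin)
open import Data.Fin.Permutation using (Permutation′; _⟨$⟩ʳ_; _⟨$⟩ˡ_; flip; inverseˡ; inverseʳ)
open import Data.Fin.Properties using (_≟_)
open import Data.Product using (Σ; ∃; _×_; _,_; proj₁; proj₂)
open import Data.Sum using (inj₁; inj₂)
open import Relation.Binary.PropositionalEquality using (_≡_; refl; sym; trans; cong; subst; subst₂)
open import Relation.Nullary using (¬_; yes; no)
open import Function using (_∘_)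
open import Function.Bundles using (_↔_; _⇔_; mk↔ₛ′; mk⇔; Equivalence)
open import Axiom.UniquenessOfIdentityProofs using (module Decidable⇒UIP)

open Equivalence using (to; from)

IsAutomorphism : {n : ℕ} → Graph (Fin n) → Permutation′ n → Set
IsAutomorphism Γ g = ∀ x y → (Adj Γ x y → Adj Γ (g ⟨$⟩ʳ x) (g ⟨$⟩ʳ y))
                           × (Adj Γ (g ⟨$⟩ʳ x) (g ⟨$⟩ʳ y) → Adj Γ x y)

IsModule : {V : Set} → Graph V → (V → Set) → Set
IsModule Γ S = ∀ {u u' v} → S u → S u' → ¬ S v → Adj Γ u v → Adj Γ u' v

module-preimage : ∀ {n} (Γ : Graph (Fin n)) (g : Permutation′ n) {S T : Fin n → Set} →
  IsModule Γ S → IsAutomorphism Γ g → (∀ x → T x ⇔ S (g ⟨$⟩ʳ x)) → IsModule Γ T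
module-preimage Γ g S-module g-aut T⇔S {u} {u'} {v} Tu Tu' ¬Tv uv =
  proj₂ (g-aut u' v)
    (S-module (to (T⇔S u) Tu) (to (T⇔S u') Tu') (¬Tv ∘ from (T⇔S v)) (proj₁ (g-aut u v) uv))

pointwiseStabTransitive⇒module : ∀ {n m} (Γ : Graph (Fin n)) {G} → IsAutGroup Γ G →
  (blk : Fin n → Fin m) (b : Fin m) → PointwiseStabTransitiveOn G blk b →
  IsModule Γ (λ x → blk x ≡ b)
pointwiseStabTransitive⇒module Γ (_ , aut) blk b st {u} {u'} {v} u∈B u'∈B v∉B uv
  with st u u' u∈B u'∈B
... | h , h∈G , h-fixes , hu≡u' =
  subst₂ (Adj Γ) hu≡u' (h-fixes v v∉B) (proj₁ (aut h h∈G u v) uv)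

module BlockSystem {n m : ℕ} {G : Permutation′ n → Set} {blk : Fin n → Fin m}
                   (sub : IsSubgroup n G) (bs : IsBlockSystem G m blk) where

  sameBlock-preserved : ∀ {g} → G g → ∀ x y →
    blk x ≡ blk y ⇔ blk (g ⟨$⟩ʳ x) ≡ blk (g ⟨$⟩ʳ y)
  sameBlock-preserved {g} g∈G x y = mk⇔ (invariant bs g g∈G x y) λ e →
    subst₂ (λ x′ y′ → blk x′ ≡ blk y′) (inverseˡ g) (inverseˡ g)
      (invariant bs (flip g) (has-inv sub g∈G) _ _ e)

  block-transporter : IsTransitive G → ∀ c b →
    ∃ λ g → G g × (∀ x → blk x ≡ c ⇔ blk (g ⟨$⟩ʳ x) ≡ b)
  block-transporter tr c b with surj bs c | surj bs b
  ... | x₀ , x₀∈C | y₀ , y₀∈B with tr x₀ y₀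
  ... | g , g∈G , gx₀≡y₀ = g , g∈G , λ x →
    let g-blocks = sameBlock-preserved g∈G x x₀
        gx₀∈B    = trans (cong blk gx₀≡y₀) y₀∈B
    in mk⇔ (λ x∈C → trans (to g-blocks (trans x∈C (sym x₀∈C))) gx₀∈B)
           (λ gx∈B → trans (from g-blocks (trans gx∈B (sym gx₀∈B))) x₀∈C)

module LexDecomposition {n m : ℕ} (Γ : Graph (Fin n)) (blk : Fin n → Fin m) (b : Fin m)
  (σ : Fin m → Permutation′ n)
  (σ-aut : ∀ c → IsAutomorphism Γ (σ c))
  (σ-block : ∀ c x → blk x ≡ c ⇔ blk (σ c ⟨$⟩ʳ x) ≡ b)
  (blocks-are-modules : ∀ c → IsModule Γ (λ x → blk x ≡ c)) where

  B : Set
  B = Σ (Fin n) λ x → blk x ≡ b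

  Lex : Graph (B × Fin m)
  Lex = lex (quotient Γ blk) (induced Γ blk b)

  toLex : Fin n → B × Fin m
  toLex x = (σ (blk x) ⟨$⟩ʳ x , to (σ-block (blk x) x) refl) , blk x

  fromLex : B × Fin m → Fin n
  fromLex ((y , _) , c) = σ c ⟨$⟩ˡ y

  toLex-unique : ∀ x c y (y∈B : blk y ≡ b) → blk x ≡ c → σ c ⟨$⟩ʳ x ≡ y →
                 toLex x ≡ ((y , y∈B) , c)
  toLex-unique x _ _ y∈B refl refl =
    cong (λ p → (_ , p) , blk x) (Decidable⇒UIP.≡-irrelevant _≟_ _ y∈B)

  toLex∘fromLex : ∀ z → toLex (fromLex z) ≡ z
  toLex∘fromLex ((y , y∈B) , c) = toLex-unique (σ c ⟨$⟩ˡ y) c y y∈B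
    (from (σ-block c _) (subst (λ y′ → blk y′ ≡ b) (sym (inverseʳ (σ c))) y∈B))
    (inverseʳ (σ c))

  fromLex∘toLex : ∀ x → fromLex (toLex x) ≡ x
  fromLex∘toLex x = inverseˡ (σ (blk x))

  toLex-bijection : Fin n ↔ (B × Fin m)
  toLex-bijection = mk↔ₛ′ toLex fromLex toLex∘fromLex fromLex∘toLex

  σ-sameBlock : ∀ {x y} → blk x ≡ blk y →
    Adj Γ (σ (blk x) ⟨$⟩ʳ x) (σ (blk x) ⟨$⟩ʳ y) ⇔ Adj Γ (σ (blk x) ⟨$⟩ʳ x) (σ (blk y) ⟨$⟩ʳ y)
  σ-sameBlock {x} {y} e = mk⇔ (subst P e) (subst P (sym e))
    where P : Fin m → Set
          P d = Adj Γ (σ (blk x) ⟨$⟩ʳ x) (σ d ⟨$⟩ʳ y)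

  toLex-preserves : ∀ x y → Adj Γ x y → Adj Lex (toLex x) (toLex y)
  toLex-preserves x y xy with blk x ≟ blk y
  ... | yes e = inj₁ (e , to (σ-sameBlock e) (proj₁ (σ-aut (blk x) x y) xy))
  ... | no ¬e = inj₂ (¬e , x , y , refl , refl , xy)

  toLex-reflects : ∀ x y → Adj Lex (toLex x) (toLex y) → Adj Γ x y
  toLex-reflects x y (inj₁ (e , σxσy)) = proj₂ (σ-aut (blk x) x y) (from (σ-sameBlock e) σxσy)
  toLex-reflects x y (inj₂ (¬e , x′ , y′ , x′∈X , y′∈Y , x′y′)) =
    Graph.sym Γ (blocks-are-modules (blk y) y′∈Y refl ¬e
      (Graph.sym Γ (blocks-are-modules (blk x) x′∈X refl (λ y′∈X → ¬e (trans (sym y′∈X) y′∈Y)) x′y′)))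

  ≅-lex : Γ ≅ Lex
  ≅-lex = toLex-bijection , λ x y → toLex-preserves x y , toLex-reflects x y

lemma3p2 : (n : ℕ) (Γ : FinGraph n) (G : Permutation′ n → Set) →
    IsAutGroup (graph Γ) G → IsTransitive G → IsImprimitive G →
    (m : ℕ) (blk : Fin n → Fin m) → IsBlockSystem G m blk →
    (b : Fin m) → PointwiseStabTransitiveOn G blk b →
    graph Γ ≅ lex (quotient (graph Γ) blk) (induced (graph Γ) blk b)
lemma3p2 n Γ G G≤Aut@(sub , aut) tr _ m blk bs b st =
  LexDecomposition.≅-lex (graph Γ) blk b σ σ-aut σ-block blocks-are-modules
  where
  open BlockSystem sub bs

  σ : Fin m → Permutation′ n
  σ c = proj₁ (block-transporter tr c b)

  σ-aut : ∀ c → IsAutomorphism (graph Γ) (σ c)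
  σ-aut c = aut (σ c) (proj₁ (proj₂ (block-transporter tr c b)))

  σ-block : ∀ c x → blk x ≡ c ⇔ blk (σ c ⟨$⟩ʳ x) ≡ b
  σ-block c = proj₂ (proj₂ (block-transporter tr c b))

  blocks-are-modules : ∀ c → IsModule (graph Γ) (λ x → blk x ≡ c)
  blocks-are-modules c =
    module-preimage (graph Γ) (σ c) (pointwiseStabTransitive⇒module (graph Γ) G≤Aut blk b st)
      (σ-aut c) (σ-block c)
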